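{- Every permutation snark has a proper $\mathbb{Z}_4\times\mathbb{Z}_2$-coloring.
   Context: A snark is a bridgeless cubic graph that is not 3-edge-colorable. A permutation snark is a snark having a $2$-factor consisting of exactly two induced (chordless) cycles (necessarily odd and of the same length). For a finite abelian group $A$, a proper $A$-coloring of a cubic graph $G$ is a map $\sigma:E(G)\to A\setminus\{0\}$ such that edges sharing a vertex receive distinct colors and at every vertex the three incident colors sum to $0$. -}

module Defs where

open import Data.Nat using (ℕ; zero; suc; _+_)
open import Data.Nat.DivMod using (_mod_)
open import Data.Fin using (Fin; toℕ)
open import Data.Bool using (Bool; true; false)
open import Data.Product using (Σ; ∃; _×_; _,_)
open import Data.Sum using (_⊎_)
open import Relation.Nullary using (¬_)
open import Relation.Binary.PropositionalEquality using (_≡_; _≢_)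
open import Relation.Binary.Construct.Closure.ReflexiveTransitive using (Star)
open import Function.Definitions using (Injective)
open import Function.Bundles using (_⇔_)

record Graph (n : ℕ) : Set where
  field
    adj    : Fin n → Fin n → Bool
    sym    : ∀ u v → adj u v ≡ adj v u
    irrefl : ∀ v → adj v v ≡ false

open Graph public

Adj : ∀ {n} → Graph n → Fin n → Fin n → Set
Adj G u v = adj G u v ≡ true

Cubic : ∀ {n} → Graph n → Set
Cubic {n} G = ∀ v → Σ (Fin 3 → Fin n) λ f →
  Injective _≡_ _≡_ f × (∀ w → Adj G v w ⇔ (∃ λ i → f i ≡ w))

AdjMinus : ∀ {n} → Graph n → Fin n → Fin n → Fin n → Fin n → Set
AdjMinus G a b x y = Adj G x y × ¬ ((x ≡ a × y ≡ b) ⊎ (x ≡ b × y ≡ a))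

-- An edge {a,b} is a bridge iff a and b are disconnected in G - ab.
-- Bridgeless: for every edge ab, b is reachable from a in G - ab.
Bridgeless : ∀ {n} → Graph n → Set
Bridgeless G = ∀ a b → Adj G a b → Star (AdjMinus G a b) a b

IsProperEdgeColoring : ∀ {n} {C : Set} → Graph n → (Fin n → Fin n → C) → Set
IsProperEdgeColoring G σ =
  (∀ u v → Adj G u v → σ u v ≡ σ v u) ×
  (∀ v w w' → Adj G v w → Adj G v w' → w ≢ w' → σ v w ≢ σ v w')

ThreeEdgeColorable : ∀ {n} → Graph n → Set
ThreeEdgeColorable {n} G = Σ (Fin n → Fin n → Fin 3) λ σ → IsProperEdgeColoring G σ

IsSnark : ∀ {n} → Graph n → Set
IsSnark G = Cubic G × Bridgeless G × ¬ ThreeEdgeColorable G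

CycSucc : ∀ {k} → Fin k → Fin k → Set
CycSucc {k} i j = (suc (toℕ i) ≡ toℕ j) ⊎ (suc (toℕ i) ≡ k × toℕ j ≡ 0)

IsInducedCycle : ∀ {n k} → Graph n → (Fin k → Fin n) → Set
IsInducedCycle {n} {k} G c =
  (3 Data.Nat.≤ k) × Injective _≡_ _≡_ c ×
  (∀ i j → Adj G (c i) (c j) ⇔ (CycSucc i j ⊎ CycSucc j i))

-- A 2-factor consisting of exactly two induced cycles: two vertex-disjoint
-- induced cycles which together cover all vertices (their edges form the 2-factor).
HasTwoInducedCycle2Factor : ∀ {n} → Graph n → Set
HasTwoInducedCycle2Factor {n} G =
  Σ ℕ λ k₁ → Σ ℕ λ k₂ → Σ (Fin k₁ → Fin n) λ c₁ → Σ (Fin k₂ → Fin n) λ c₂ →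
    IsInducedCycle G c₁ × IsInducedCycle G c₂ ×
    (∀ i j → c₁ i ≢ c₂ j) ×
    (∀ v → (∃ λ i → c₁ i ≡ v) ⊎ (∃ λ j → c₂ j ≡ v))

IsPermutationSnark : ∀ {n} → Graph n → Set
IsPermutationSnark G = IsSnark G × HasTwoInducedCycle2Factor G

Z4×Z2 : Set
Z4×Z2 = Fin 4 × Fin 2

0ₐ : Z4×Z2
0ₐ = Data.Fin.zero , Data.Fin.zero

_⊕_ : Z4×Z2 → Z4×Z2 → Z4×Z2
(a , b) ⊕ (a' , b') = ((toℕ a + toℕ a') mod 4) , ((toℕ b + toℕ b') mod 2)
infixl 6 _⊕_

IsProperZ4Z2Coloring : ∀ {n} → Graph n → (Fin n → Fin n → Z4×Z2) → Set
IsProperZ4Z2Coloring G σ =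
  IsProperEdgeColoring G σ ×
  (∀ u v → Adj G u v → σ u v ≢ 0ₐ) ×
  (∀ v w₁ w₂ w₃ → Adj G v w₁ → Adj G v w₂ → Adj G v w₃ →
     w₁ ≢ w₂ → w₁ ≢ w₃ → w₂ ≢ w₃ →
     σ v w₁ ⊕ σ v w₂ ⊕ σ v w₃ ≡ 0ₐ)

HasProperZ4Z2Coloring : ∀ {n} → Graph n → Set
HasProperZ4Z2Coloring {n} G = Σ (Fin n → Fin n → Z4×Z2) λ σ → IsProperZ4Z2Coloring G σ

-- Only cubicity and the 2-factor matter.  The edges outside the two induced
-- cycles C₁, C₂ form a perfect matching between them, so both cycles have the
-- same length k.  Colour cycle edges (x, 1) and matching edges (m, 0); a vertex
-- is then fine iff m ≠ 0, x ≠ y and x + y + m ≡ 0 (mod 4), where x, y are the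
-- colours of its two cycle edges and m that of its matching edge.  Choose two
-- vertices a, b on C₁ and their partners on C₂.  On each cycle, the arc from b
-- to a is coloured 0, 1, 0, 1, … and the arc from a back to b is coloured
-- 2, 3, 2, 3, …; matching edges get 3, except at a (colour 1) and at b (colour
-- 1 or 2, according to the parity of k − 1).  The matching colours only depend
-- on whether a vertex is a, b or neither, and the matching pairs these roles,
-- so both cycles agree on them.
module Submission where

open import Defs hiding (sym)
open import Data.Nat as ℕ
  using (ℕ; suc; _+_; _∸_; _≤_; _<_; z≤n; s≤s; _≤?_; _<?_; NonZero; parity)
open import Data.Nat.Properties hiding (_≟_)
open import Data.Nat.DivMod using (_%_; _mod_; %-distribˡ-+; m%n%n≡m%n)
open import Data.Parity.Base using (Parity; 0ℙ; 1ℙ; _⁻¹)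
open import Data.Parity.Properties using (⁻¹-selfInverse; suc-homo-⁻¹)
open import Data.Fin as Fin using (Fin; toℕ; fromℕ; fromℕ<; inject₁; lower₁)
open import Data.Fin.Patterns using (0F; 1F; 2F; 3F)
open import Data.Fin.Properties
  using (toℕ-injective; toℕ<n; toℕ-fromℕ; toℕ-fromℕ<; toℕ-inject₁; toℕ-lower₁; injective⇒≤; _≟_)
open import Data.Vec using (Vec; []; _∷_; lookup)
open import Data.Vec.Relation.Unary.All using (All; []; _∷_)
open import Data.Vec.Relation.Unary.All.Properties using (lookup⁺)
open import Data.Vec.Relation.Unary.AllPairs using ([]; _∷_)
open import Data.Vec.Relation.Unary.Unique.Propositional using (Unique)
open import Data.Vec.Relation.Unary.Unique.Propositional.Properties using (lookup-injective)
open import Data.Bool using (Bool; true; false; if_then_else_)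
open import Data.Product using (∃; _×_; _,_; proj₁; proj₂)
open import Data.Sum as Sum using (_⊎_; inj₁; inj₂; [_,_]′)
open import Function using (_∘_; const)
open import Function.Bundles using (Equivalence)
open import Function.Definitions using (Injective)
open import Relation.Nullary using (Dec; yes; no; does; ¬_; contradiction)
open import Relation.Nullary.Decidable using (dec-true; dec-false; _⊎-dec_; _×-dec_)
open import Relation.Binary.PropositionalEquality

open Equivalence using (to; from)

-- Arithmetic in Z₄ × Z₂

[m%d+n]%d≡[m+n]%d : ∀ m n d .{{_ : NonZero d}} → (m % d + n) % d ≡ (m + n) % d
[m%d+n]%d≡[m+n]%d m n d = begin
  (m % d + n) % d          ≡⟨ %-distribˡ-+ (m % d) n d ⟩
  (m % d % d + n % d) % d  ≡⟨ cong (λ r → (r + n % d) % d) (m%n%n≡m%n m d) ⟩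
  (m % d + n % d) % d      ≡⟨ %-distribˡ-+ m n d ⟨
  (m + n) % d              ∎
  where open ≡-Reasoning

[[m+n]%d+o]%d≡[m+[n+o]%d]%d : ∀ m n o d .{{_ : NonZero d}} →
                              ((m + n) % d + o) % d ≡ (m + (n + o) % d) % d
[[m+n]%d+o]%d≡[m+[n+o]%d]%d m n o d = begin
  ((m + n) % d + o) % d  ≡⟨ [m%d+n]%d≡[m+n]%d (m + n) o d ⟩
  (m + n + o) % d        ≡⟨ cong (λ r → r % d) (trans (+-assoc m n o) (+-comm m (n + o))) ⟩
  (n + o + m) % d        ≡⟨ [m%d+n]%d≡[m+n]%d (n + o) m d ⟨
  ((n + o) % d + m) % d  ≡⟨ cong (λ r → r % d) (+-comm ((n + o) % d) m) ⟩
  (m + (n + o) % d) % d  ∎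
  where open ≡-Reasoning

toℕ-mod : ∀ m d .{{_ : NonZero d}} → toℕ (m mod d) ≡ m % d
toℕ-mod m d = toℕ-fromℕ< _

+-mod-comm : ∀ d .{{_ : NonZero d}} (x y : Fin d) →
             (toℕ x + toℕ y) mod d ≡ (toℕ y + toℕ x) mod d
+-mod-comm d x y = cong (λ r → r mod d) (+-comm (toℕ x) (toℕ y))

+-mod-assoc : ∀ d .{{_ : NonZero d}} (x y z : Fin d) →
              (toℕ ((toℕ x + toℕ y) mod d) + toℕ z) mod d ≡
              (toℕ x + toℕ ((toℕ y + toℕ z) mod d)) mod d
+-mod-assoc d x y z = toℕ-injective (begin
  toℕ ((toℕ ((a + b) mod d) + c) mod d)  ≡⟨ toℕ-mod _ d ⟩
  (toℕ ((a + b) mod d) + c) % d          ≡⟨ cong (λ r → (r + c) % d) (toℕ-mod (a + b) d) ⟩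
  ((a + b) % d + c) % d                  ≡⟨ [[m+n]%d+o]%d≡[m+[n+o]%d]%d a b c d ⟩
  (a + (b + c) % d) % d                  ≡⟨ cong (λ r → (a + r) % d) (toℕ-mod (b + c) d) ⟨
  (a + toℕ ((b + c) mod d)) % d          ≡⟨ toℕ-mod _ d ⟨
  toℕ ((a + toℕ ((b + c) mod d)) mod d)  ∎)
  where
  open ≡-Reasoning
  a = toℕ x
  b = toℕ y
  c = toℕ z

⊕-comm : ∀ x y → x ⊕ y ≡ y ⊕ x
⊕-comm (a , b) (a′ , b′) = cong₂ _,_ (+-mod-comm 4 a a′) (+-mod-comm 2 b b′)

⊕-assoc : ∀ x y z → x ⊕ y ⊕ z ≡ x ⊕ (y ⊕ z)
⊕-assoc (a , b) (a′ , b′) (a″ , b″) = cong₂ _,_ (+-mod-assoc 4 a a′ a″) (+-mod-assoc 2 b b′ b″)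

⊕-swapʳ : ∀ x y z → x ⊕ y ⊕ z ≡ x ⊕ z ⊕ y
⊕-swapʳ x y z = begin
  x ⊕ y ⊕ z    ≡⟨ ⊕-assoc x y z ⟩
  x ⊕ (y ⊕ z)  ≡⟨ cong (x ⊕_) (⊕-comm y z) ⟩
  x ⊕ (z ⊕ y)  ≡⟨ ⊕-assoc x z y ⟨
  x ⊕ z ⊕ y    ∎
  where open ≡-Reasoning

⊕-swapˡ : ∀ x y z → x ⊕ y ⊕ z ≡ y ⊕ x ⊕ z
⊕-swapˡ x y z = cong (_⊕ z) (⊕-comm x y)

⊕-sum-distinct : (g : Fin 3 → Z4×Z2) {s t u : Fin 3} → s ≢ t → s ≢ u → t ≢ u →
                 g s ⊕ g t ⊕ g u ≡ g 0F ⊕ g 1F ⊕ g 2F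
⊕-sum-distinct g {0F} {1F} {2F} _ _ _ = refl
⊕-sum-distinct g {0F} {2F} {1F} _ _ _ = ⊕-swapʳ (g 0F) (g 2F) (g 1F)
⊕-sum-distinct g {1F} {0F} {2F} _ _ _ = ⊕-swapˡ (g 1F) (g 0F) (g 2F)
⊕-sum-distinct g {1F} {2F} {0F} _ _ _ =
  trans (⊕-swapʳ (g 1F) (g 2F) (g 0F)) (⊕-swapˡ (g 1F) (g 0F) (g 2F))
⊕-sum-distinct g {2F} {0F} {1F} _ _ _ =
  trans (⊕-swapˡ (g 2F) (g 0F) (g 1F)) (⊕-swapʳ (g 0F) (g 2F) (g 1F))
⊕-sum-distinct g {2F} {1F} {0F} _ _ _ =
  trans (⊕-swapˡ (g 2F) (g 1F) (g 0F))
        (trans (⊕-swapʳ (g 1F) (g 2F) (g 0F)) (⊕-swapˡ (g 1F) (g 0F) (g 2F)))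
⊕-sum-distinct g {0F} {0F} s≢t _ _ = contradiction refl s≢t
⊕-sum-distinct g {1F} {1F} s≢t _ _ = contradiction refl s≢t
⊕-sum-distinct g {2F} {2F} s≢t _ _ = contradiction refl s≢t
⊕-sum-distinct g {0F} {_} {0F} _ s≢u _ = contradiction refl s≢u
⊕-sum-distinct g {1F} {_} {1F} _ s≢u _ = contradiction refl s≢u
⊕-sum-distinct g {2F} {_} {2F} _ s≢u _ = contradiction refl s≢u
⊕-sum-distinct g {_} {0F} {0F} _ _ t≢u = contradiction refl t≢u
⊕-sum-distinct g {_} {1F} {1F} _ _ t≢u = contradiction refl t≢u
⊕-sum-distinct g {_} {2F} {2F} _ _ t≢u = contradiction refl t≢u

-- x and y colour the two cycle edges at a vertex, m its third edge.
Balanced : Fin 4 → Fin 4 → Fin 4 → Set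
Balanced x y m = x ≢ y × (x , 1F) ⊕ (y , 1F) ⊕ (m , 0F) ≡ 0ₐ

Balanced-cong : ∀ {x x′ y y′ m m′} → x ≡ x′ → y ≡ y′ → m ≡ m′ → Balanced x y m → Balanced x′ y′ m′
Balanced-cong refl refl refl balanced = balanced

-- The first argument tells whether the edge lies on the arc from b to a.
arcColour : Bool → Parity → Fin 4
arcColour true  0ℙ = 0F
arcColour true  1ℙ = 1F
arcColour false 0ℙ = 2F
arcColour false 1ℙ = 3F

closingColour : Parity → Fin 4
closingColour 0ℙ = 2F
closingColour 1ℙ = 1F

closingColour≢0 : ∀ p → closingColour p ≢ 0F
closingColour≢0 0ℙ ()
closingColour≢0 1ℙ ()

closing-balanced : ∀ p → Balanced (arcColour true 0ℙ) (arcColour false p) (closingColour p)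
closing-balanced 0ℙ = (λ ()) , refl
closing-balanced 1ℙ = (λ ()) , refl

turning-balanced : ∀ p → Balanced (arcColour false (p ⁻¹)) (arcColour true p) 1F
turning-balanced 0ℙ = (λ ()) , refl
turning-balanced 1ℙ = (λ ()) , refl

inner-balanced : ∀ u p → Balanced (arcColour u (p ⁻¹)) (arcColour u p) 3F
inner-balanced true  0ℙ = (λ ()) , refl
inner-balanced true  1ℙ = (λ ()) , refl
inner-balanced false 0ℙ = (λ ()) , refl
inner-balanced false 1ℙ = (λ ()) , refl

parity-suc : ∀ n → parity (suc n) ≡ parity n ⁻¹
parity-suc n = sym (⁻¹-selfInverse (suc-homo-⁻¹ n))

-- Cycles

module _ {k : ℕ} where

  cycSucc? : (i j : Fin k) → Dec (CycSucc i j)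
  cycSucc? i j = suc (toℕ i) ℕ.≟ toℕ j ⊎-dec (suc (toℕ i) ℕ.≟ k ×-dec toℕ j ℕ.≟ 0)

  cycSucc-functional : ∀ {i j j′ : Fin k} → CycSucc i j → CycSucc i j′ → j ≡ j′
  cycSucc-functional (inj₁ e) (inj₁ e′) = toℕ-injective (trans (sym e) e′)
  cycSucc-functional {j = j} (inj₁ e) (inj₂ (e′ , _)) = contradiction (trans (sym e) e′) (<⇒≢ (toℕ<n j))
  cycSucc-functional {j′ = j′} (inj₂ (e , _)) (inj₁ e′) = contradiction (trans (sym e′) e) (<⇒≢ (toℕ<n j′))
  cycSucc-functional (inj₂ (_ , e)) (inj₂ (_ , e′)) = toℕ-injective (trans e (sym e′))

  cycSucc-injective : ∀ {i i′ j : Fin k} → CycSucc i j → CycSucc i′ j → i ≡ i′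
  cycSucc-injective (inj₁ e) (inj₁ e′) = toℕ-injective (suc-injective (trans e (sym e′)))
  cycSucc-injective (inj₁ e) (inj₂ (_ , e′)) = contradiction (trans e e′) 1+n≢0
  cycSucc-injective (inj₂ (_ , e)) (inj₁ e′) = contradiction (trans e′ e) 1+n≢0
  cycSucc-injective (inj₂ (e , _)) (inj₂ (e′ , _)) = toℕ-injective (suc-injective (trans e (sym e′)))

  cycSucc-asym : 3 ≤ k → ∀ {i j : Fin k} → CycSucc i j → ¬ CycSucc j i
  cycSucc-asym _ {i} (inj₁ e) (inj₁ e′) =
    contradiction (trans (cong suc e) e′) (<⇒≢ (m<n⇒m<1+n (n<1+n (toℕ i))) ∘ sym)
  cycSucc-asym 3≤k (inj₁ e) (inj₂ (e′ , e″)) =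
    contradiction (trans (sym e′) (cong suc (trans (sym e) (cong suc e″)))) (<⇒≢ 3≤k ∘ sym)
  cycSucc-asym 3≤k (inj₂ (e , e′)) (inj₁ e″) =
    contradiction (trans (sym e) (cong suc (trans (sym e″) (cong suc e′)))) (<⇒≢ 3≤k ∘ sym)
  cycSucc-asym 3≤k (inj₂ (_ , e)) (inj₂ (e′ , _)) =
    contradiction (trans (sym e′) (cong suc e)) (<⇒≢ (≤-trans (s≤s (s≤s z≤n)) 3≤k) ∘ sym)

cycNext : ∀ {k} (i : Fin k) → ∃ (CycSucc i)
cycNext {suc n} i with toℕ i ℕ.≟ n
... | yes i≡n = 0F , inj₂ (cong suc i≡n , refl)
... | no i≢n = lower₁ (Fin.suc i) ≢i , inj₁ (sym (toℕ-lower₁ (Fin.suc i) ≢i))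
  where
  ≢i : suc n ≢ suc (toℕ i)
  ≢i = i≢n ∘ sym ∘ suc-injective

cycPrev : ∀ {k} (i : Fin k) → ∃ λ p → CycSucc p i
cycPrev {suc n} 0F = fromℕ n , inj₂ (cong suc (toℕ-fromℕ n) , refl)
cycPrev {suc n} (Fin.suc i) = inject₁ i , inj₁ (cong suc (toℕ-inject₁ i))

module _ {k : ℕ} where

  next prev : Fin k → Fin k
  next i = proj₁ (cycNext i)
  prev i = proj₁ (cycPrev i)

  next-succ : ∀ i → CycSucc i (next i)
  next-succ i = proj₂ (cycNext i)

  prev-succ : ∀ i → CycSucc (prev i) i
  prev-succ i = proj₂ (cycPrev i)

  -- ℓ i colours the cycle edge {i, next i}.
  edgeLabel : (Fin k → Fin 4) → Fin k → Fin k → Fin 4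
  edgeLabel ℓ i j = if does (cycSucc? i j) then ℓ i else ℓ j

  edgeLabel-next : ∀ ℓ {i j} → CycSucc i j → edgeLabel ℓ i j ≡ ℓ i
  edgeLabel-next ℓ {i} {j} s = cong (if_then ℓ i else ℓ j) (dec-true (cycSucc? i j) s)

  edgeLabel-prev : 3 ≤ k → ∀ ℓ {i j} → CycSucc j i → edgeLabel ℓ i j ≡ ℓ j
  edgeLabel-prev 3≤k ℓ {i} {j} s =
    cong (if_then ℓ i else ℓ j) (dec-false (cycSucc? i j) (λ s′ → cycSucc-asym 3≤k s′ s))

  edgeLabel-sym : 3 ≤ k → ∀ ℓ {i j} → CycSucc i j ⊎ CycSucc j i → edgeLabel ℓ i j ≡ edgeLabel ℓ j i
  edgeLabel-sym 3≤k ℓ (inj₁ s) = trans (edgeLabel-next ℓ s) (sym (edgeLabel-prev 3≤k ℓ s))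
  edgeLabel-sym 3≤k ℓ (inj₂ s) = trans (edgeLabel-prev 3≤k ℓ s) (sym (edgeLabel-next ℓ s))

-- Position on the cycle, counted forwards from b

module Offset {k : ℕ} (b : Fin k) where

  private
    B : ℕ
    B = toℕ b

    B<k : B < k
    B<k = toℕ<n b

    offsetℕ : ℕ → ℕ
    offsetℕ x with B ≤? x
    ... | yes _ = x ∸ B
    ... | no _  = x + (k ∸ B)

    offsetℕ<k : ∀ {x} → x < k → offsetℕ x < k
    offsetℕ<k {x} x<k with B ≤? x
    ... | yes _   = ≤-<-trans (m∸n≤m x B) x<k
    ... | no B≰x  = begin-strict
      x + (k ∸ B)  <⟨ +-monoˡ-< (k ∸ B) (≰⇒> B≰x) ⟩
      B + (k ∸ B)  ≡⟨ m+[n∸m]≡n (<⇒≤ B<k) ⟩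
      k            ∎
      where open ≤-Reasoning

    after<before : ∀ {x} y → x < k → B ≤ x → x ∸ B < y + (k ∸ B)
    after<before y x<k B≤x = <-≤-trans (∸-monoˡ-< x<k B≤x) (m≤n+m (k ∸ B) y)

    offsetℕ-injective : ∀ {x y} → x < k → y < k → offsetℕ x ≡ offsetℕ y → x ≡ y
    offsetℕ-injective {x} {y} x<k y<k e with B ≤? x | B ≤? y
    ... | yes B≤x | yes B≤y = begin
      x          ≡⟨ m∸n+n≡m B≤x ⟨
      x ∸ B + B  ≡⟨ cong (_+ B) e ⟩
      y ∸ B + B  ≡⟨ m∸n+n≡m B≤y ⟩
      y          ∎
      where open ≡-Reasoning
    ... | yes B≤x | no _    = contradiction e (<⇒≢ (after<before y x<k B≤x))
    ... | no _    | yes B≤y = contradiction (sym e) (<⇒≢ (after<before x y<k B≤y))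
    ... | no _    | no _    = +-cancelʳ-≡ (k ∸ B) x y e

    offsetℕ-suc : ∀ x y → suc x ≡ y ⊎ (suc x ≡ k × y ≡ 0) → y ≢ B → offsetℕ y ≡ suc (offsetℕ x)
    offsetℕ-suc x .(suc x) (inj₁ refl) y≢B with B ≤? x | B ≤? suc x
    ... | yes B≤x | yes _ = +-∸-assoc 1 B≤x
    ... | yes B≤x | no B≰1+x = contradiction (m≤n⇒m≤1+n B≤x) B≰1+x
    ... | no B≰x  | yes B≤1+x = [ (λ B<1+x → contradiction (≤-pred B<1+x) B≰x)
                                 , (λ B≡1+x → contradiction (sym B≡1+x) y≢B) ]′ (m≤n⇒m<n∨m≡n B≤1+x)
    ... | no _    | no _ = refl
    offsetℕ-suc x .0 (inj₂ (1+x≡k , refl)) y≢B with B ≤? 0 | B ≤? x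
    ... | yes B≤0 | _      = contradiction (sym (n≤0⇒n≡0 B≤0)) y≢B
    ... | no _    | yes B≤x = trans (cong (_∸ B) (sym 1+x≡k)) (+-∸-assoc 1 B≤x)
    ... | no _    | no B≰x  = contradiction (≤-pred (subst (B <_) (sym 1+x≡k) B<k)) B≰x

    offsetℕ-wrap : ∀ x → suc x ≡ B ⊎ (suc x ≡ k × B ≡ 0) → suc (offsetℕ x) ≡ k
    offsetℕ-wrap x s with B ≤? x
    offsetℕ-wrap x (inj₁ 1+x≡B) | yes B≤x = contradiction (subst (_≤ x) (sym 1+x≡B) B≤x) (1+n≰n)
    offsetℕ-wrap x (inj₁ 1+x≡B) | no _ = trans (cong (_+ (k ∸ B)) 1+x≡B) (m+[n∸m]≡n (<⇒≤ B<k))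
    offsetℕ-wrap x (inj₂ (1+x≡k , B≡0)) | yes _ = subst (λ z → suc (x ∸ z) ≡ k) (sym B≡0) 1+x≡k
    offsetℕ-wrap x (inj₂ (1+x≡k , B≡0)) | no B≰x = contradiction (subst (_≤ x) (sym B≡0) z≤n) B≰x

  offset : Fin k → ℕ
  offset i = offsetℕ (toℕ i)

  offset-b : offset b ≡ 0
  offset-b with B ≤? B
  ... | yes _   = n∸n≡0 B
  ... | no B≰B = contradiction ≤-refl B≰B

  offset<k : ∀ i → offset i < k
  offset<k i = offsetℕ<k (toℕ<n i)

  offset-injective : Injective _≡_ _≡_ offset
  offset-injective {i} {j} e = toℕ-injective (offsetℕ-injective (toℕ<n i) (toℕ<n j) e)

  offset-suc : ∀ {p i} → CycSucc p i → i ≢ b → offset i ≡ suc (offset p)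
  offset-suc {p} {i} s i≢b = offsetℕ-suc (toℕ p) (toℕ i) s (i≢b ∘ toℕ-injective)

  offset-wrap : ∀ {p} → CycSucc p b → suc (offset p) ≡ k
  offset-wrap {p} s = offsetℕ-wrap (toℕ p) s

-- Labelling one cycle

record IsMarking {k} (a b : Fin k) (m : Fin k → Fin 4) : Set where
  field
    at-b      : m b ≡ closingColour (parity (ℕ.pred k))
    at-a      : m a ≡ 1F
    elsewhere : ∀ {i} → i ≢ a → i ≢ b → m i ≡ 3F

markingColour : ∀ {k} (a b : Fin k) → Fin k → Fin 4
markingColour {k} a b i with i ≟ b | i ≟ a
... | yes _ | _     = closingColour (parity (ℕ.pred k))
... | no _  | yes _ = 1F
... | no _  | no _  = 3F

markingColour≢0 : ∀ {k} (a b i : Fin k) → markingColour a b i ≢ 0F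
markingColour≢0 {k} a b i with i ≟ b | i ≟ a
... | yes _ | _     = closingColour≢0 (parity (ℕ.pred k))
... | no _  | yes _ = λ ()
... | no _  | no _  = λ ()

markingColour-isMarking : ∀ {k} {a b : Fin k} → a ≢ b → IsMarking a b (markingColour a b)
markingColour-isMarking {k} {a} {b} a≢b = record { at-b = at-b ; at-a = at-a ; elsewhere = elsewhere }
  where
  at-b : markingColour a b b ≡ closingColour (parity (ℕ.pred k))
  at-b with b ≟ b
  ... | yes _   = refl
  ... | no b≢b = contradiction refl b≢b

  at-a : markingColour a b a ≡ 1F
  at-a with a ≟ b | a ≟ a
  ... | yes a≡b | _       = contradiction a≡b a≢b
  ... | no _    | yes _   = refl
  ... | no _    | no a≢a = contradiction refl a≢a

  elsewhere : ∀ {i} → i ≢ a → i ≢ b → markingColour a b i ≡ 3F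
  elsewhere {i} i≢a i≢b with i ≟ b | i ≟ a
  ... | yes i≡b | _       = contradiction i≡b i≢b
  ... | no _    | yes i≡a = contradiction i≡a i≢a
  ... | no _    | no _    = refl

module ArcLabelling {k : ℕ} (a b : Fin k) (a≢b : a ≢ b) where
  open Offset b

  colour : ℕ → Fin 4
  colour z = arcColour (does (z <? offset a)) (parity z)

  label : Fin k → Fin 4
  label i = colour (offset i)

  private
    colour-below : ∀ {z} → z < offset a → colour z ≡ arcColour true (parity z)
    colour-below {z} z<a = cong (λ u → arcColour u (parity z)) (dec-true (z <? offset a) z<a)

    colour-above : ∀ {z} → offset a ≤ z → colour z ≡ arcColour false (parity z)
    colour-above {z} a≤z = cong (λ u → arcColour u (parity z)) (dec-false (z <? offset a) (≤⇒≯ a≤z))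

    <?-suc : ∀ {z A} → suc z ≢ A → does (suc z <? A) ≡ does (z <? A)
    <?-suc {z} {A} 1+z≢A = same-answer (z <? A)
      where
      same-answer : (z<?A : Dec (z < A)) → does (suc z <? A) ≡ does z<?A
      same-answer (yes z<A) = dec-true (suc z <? A) (≤∧≢⇒< z<A 1+z≢A)
      same-answer (no z≮A)  = dec-false (suc z <? A) (z≮A ∘ <-trans (n<1+n z))

    colour-suc : ∀ z → suc z ≢ offset a →
                 colour (suc z) ≡ arcColour (does (z <? offset a)) (parity z ⁻¹)
    colour-suc z 1+z≢a = cong₂ arcColour (<?-suc 1+z≢a) (parity-suc z)

    offset-a≢0 : offset a ≢ 0
    offset-a≢0 e = a≢b (offset-injective (trans e (sym offset-b)))

  module _ {m : Fin k → Fin 4} (marking : IsMarking a b m) where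
    open IsMarking marking

    label-balanced-b : Balanced (label b) (label (prev b)) (m b)
    label-balanced-b = Balanced-cong (sym label-b) (sym label-p) (sym at-b) (closing-balanced _)
      where
      p = prev b
      wrap : suc (offset p) ≡ k
      wrap = offset-wrap (prev-succ b)

      label-b : label b ≡ arcColour true 0ℙ
      label-b = trans (cong colour offset-b) (colour-below (n≢0⇒n>0 offset-a≢0))

      label-p : label p ≡ arcColour false (parity (ℕ.pred k))
      label-p = trans (colour-above (≤-pred (subst (offset a <_) (sym wrap) (offset<k a))))
                      (cong (arcColour false ∘ parity ∘ ℕ.pred) wrap)

    label-balanced-a : Balanced (label a) (label (prev a)) (m a)
    label-balanced-a = Balanced-cong (sym label-a) (sym label-p) (sym at-a) (turning-balanced _)
      where
      p = prev a
      a≡1+p : offset a ≡ suc (offset p)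
      a≡1+p = offset-suc (prev-succ a) a≢b

      label-a : label a ≡ arcColour false (parity (offset p) ⁻¹)
      label-a = trans (colour-above ≤-refl)
                      (cong (arcColour false) (trans (cong parity a≡1+p) (parity-suc (offset p))))

      label-p : label p ≡ arcColour true (parity (offset p))
      label-p = colour-below (subst (offset p <_) (sym a≡1+p) (n<1+n _))

    label-balanced-inner : ∀ {i} → i ≢ a → i ≢ b → Balanced (label i) (label (prev i)) (m i)
    label-balanced-inner {i} i≢a i≢b =
      Balanced-cong (sym label-i) refl (sym (elsewhere i≢a i≢b)) (inner-balanced _ _)
      where
      p = prev i
      i≡1+p : offset i ≡ suc (offset p)
      i≡1+p = offset-suc (prev-succ i) i≢b

      label-i : label i ≡ arcColour (does (offset p <? offset a)) (parity (offset p) ⁻¹)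
      label-i = trans (cong colour i≡1+p)
                      (colour-suc (offset p) (λ e → i≢a (offset-injective (trans i≡1+p e))))

    label-balanced : ∀ i → Balanced (label i) (label (prev i)) (m i)
    label-balanced i with i ≟ b | i ≟ a
    ... | yes refl | _        = label-balanced-b
    ... | no _     | yes refl = label-balanced-a
    ... | no i≢b   | no i≢a   = label-balanced-inner i≢a i≢b

module _ {n} (G : Graph n) where

  adj-sym : ∀ {u v} → Adj G u v → Adj G v u
  adj-sym {u} {v} uv = trans (Graph.sym G v u) uv

  cubic-neighbours-≤3 : Cubic G → ∀ v {m} (ws : Vec (Fin n) m) → Unique ws → All (Adj G v) ws → m ≤ 3
  cubic-neighbours-≤3 cubic v ws unique adjacent with cubic v
  ... | f , f-injective , spec = injective⇒≤ index-injective
    where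
    index : Fin _ → Fin 3
    index t = proj₁ (to (spec (lookup ws t)) (lookup⁺ adjacent t))

    f-index : ∀ t → f (index t) ≡ lookup ws t
    f-index t = proj₂ (to (spec (lookup ws t)) (lookup⁺ adjacent t))

    index-injective : Injective _≡_ _≡_ index
    index-injective {t} {t′} e =
      lookup-injective unique t t′ (trans (sym (f-index t)) (trans (cong f e) (f-index t′)))

  module _ (σ : Fin n → Fin n → Z4×Z2) where

    DistinctAt : Fin n → Set
    DistinctAt v = ∀ w w′ → Adj G v w → Adj G v w′ → w ≢ w′ → σ v w ≢ σ v w′

    ZeroSumAt : Fin n → Set
    ZeroSumAt v = ∀ w₁ w₂ w₃ → Adj G v w₁ → Adj G v w₂ → Adj G v w₃ →
                  w₁ ≢ w₂ → w₁ ≢ w₃ → w₂ ≢ w₃ → σ v w₁ ⊕ σ v w₂ ⊕ σ v w₃ ≡ 0ₐ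

    ProperAt : Fin n → Set
    ProperAt v = DistinctAt v × ZeroSumAt v

    properAt-enumerated : ∀ v (nb : Fin 3 → Fin n) → (∀ {w} → Adj G v w → ∃ λ t → nb t ≡ w) →
                (g : Fin 3 → Z4×Z2) → Injective _≡_ _≡_ g → (∀ t → σ v (nb t) ≡ g t) →
                g 0F ⊕ g 1F ⊕ g 2F ≡ 0ₐ → ProperAt v
    properAt-enumerated v nb onto g g-injective σ≡g sum = distinct , zeroSum
      where
      index : ∀ {w} → Adj G v w → Fin 3
      index vw = proj₁ (onto vw)

      σ≡g-index : ∀ {w} (vw : Adj G v w) → σ v w ≡ g (index vw)
      σ≡g-index vw = trans (cong (σ v) (sym (proj₂ (onto vw)))) (σ≡g (index vw))

      index-injective : ∀ {w w′} (vw : Adj G v w) (vw′ : Adj G v w′) → index vw ≡ index vw′ → w ≡ w′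
      index-injective vw vw′ e = trans (sym (proj₂ (onto vw))) (trans (cong nb e) (proj₂ (onto vw′)))

      distinct : DistinctAt v
      distinct w w′ vw vw′ w≢w′ σ≡ =
        w≢w′ (index-injective vw vw′ (g-injective (trans (sym (σ≡g-index vw)) (trans σ≡ (σ≡g-index vw′)))))

      zeroSum : ZeroSumAt v
      zeroSum w₁ w₂ w₃ v₁ v₂ v₃ w₁≢w₂ w₁≢w₃ w₂≢w₃ = begin
        σ v w₁ ⊕ σ v w₂ ⊕ σ v w₃
          ≡⟨ cong₂ _⊕_ (cong₂ _⊕_ (σ≡g-index v₁) (σ≡g-index v₂)) (σ≡g-index v₃) ⟩
        g (index v₁) ⊕ g (index v₂) ⊕ g (index v₃)
          ≡⟨ ⊕-sum-distinct g (w₁≢w₂ ∘ index-injective v₁ v₂) (w₁≢w₃ ∘ index-injective v₁ v₃)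
                              (w₂≢w₃ ∘ index-injective v₂ v₃) ⟩
        g 0F ⊕ g 1F ⊕ g 2F
          ≡⟨ sum ⟩
        0ₐ ∎
        where open ≡-Reasoning

injective-into-pair⇒≤2 : ∀ {m} {A : Set} {x y : A} (f : Fin m → A) → Injective _≡_ _≡_ f →
                         (∀ t → f t ≡ x ⊎ f t ≡ y) → m ≤ 2
injective-into-pair⇒≤2 {m} f f-injective in-pair = injective⇒≤ side-injective
  where
  side : Fin m → Fin 2
  side t = [ const 0F , const 1F ]′ (in-pair t)

  side-injective : Injective _≡_ _≡_ side
  side-injective {t} {t′} e with in-pair t | in-pair t′
  ... | inj₁ p | inj₁ q = f-injective (trans p (sym q))
  ... | inj₂ p | inj₂ q = f-injective (trans p (sym q))
  ... | inj₁ _ | inj₂ _ = contradiction e λ ()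
  ... | inj₂ _ | inj₁ _ = contradiction e λ ()

module FactorCycle {n} (G : Graph n) (cubic : Cubic G) {kA kB}
  (cA : Fin kA → Fin n) (cB : Fin kB → Fin n)
  (indA : IsInducedCycle G cA) (cB-injective : Injective _≡_ _≡_ cB)
  (disjoint : ∀ i j → cA i ≢ cB j)
  (cover : ∀ v → (∃ λ i → cA i ≡ v) ⊎ (∃ λ j → cB j ≡ v)) where

  3≤kA : 3 ≤ kA
  3≤kA = proj₁ indA

  cA-injective : Injective _≡_ _≡_ cA
  cA-injective = proj₁ (proj₂ indA)

  adjA : ∀ i j → Adj G (cA i) (cA j) → CycSucc i j ⊎ CycSucc j i
  adjA i j = to (proj₂ (proj₂ indA) i j)

  adj-next : ∀ i → Adj G (cA i) (cA (next i))
  adj-next i = from (proj₂ (proj₂ indA) i (next i)) (inj₁ (next-succ i))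

  adj-prev : ∀ i → Adj G (cA i) (cA (prev i))
  adj-prev i = from (proj₂ (proj₂ indA) i (prev i)) (inj₂ (prev-succ i))

  next≢prev : ∀ i → cA (next i) ≢ cA (prev i)
  next≢prev i e =
    cycSucc-asym 3≤kA (next-succ i) (subst (λ j → CycSucc j i) (sym (cA-injective e)) (prev-succ i))

  neighbour-cases : ∀ i {w} → Adj G (cA i) w →
                    (w ≡ cA (next i) ⊎ w ≡ cA (prev i)) ⊎ (∃ λ j → cB j ≡ w)
  neighbour-cases i {w} iw with cover w
  ... | inj₂ onB = inj₂ onB
  ... | inj₁ (j , refl) with adjA i j iw
  ...   | inj₁ s = inj₁ (inj₁ (cong cA (cycSucc-functional s (next-succ i))))
  ...   | inj₂ s = inj₁ (inj₂ (cong cA (cycSucc-injective s (prev-succ i))))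

  cross-unique : ∀ {i j j′} → Adj G (cA i) (cB j) → Adj G (cA i) (cB j′) → j ≡ j′
  cross-unique {i} {j} {j′} ij ij′ with j ≟ j′
  ... | yes j≡j′ = j≡j′
  ... | no j≢j′ = contradiction (cubic-neighbours-≤3 G cubic (cA i) _ unique adjacent) 1+n≰n
    where
    unique : Unique (cA (next i) ∷ cA (prev i) ∷ cB j ∷ cB j′ ∷ [])
    unique = (next≢prev i ∷ disjoint _ _ ∷ disjoint _ _ ∷ [])
           ∷ (disjoint _ _ ∷ disjoint _ _ ∷ [])
           ∷ ((j≢j′ ∘ cB-injective) ∷ [])
           ∷ [] ∷ []

    adjacent : All (Adj G (cA i)) (cA (next i) ∷ cA (prev i) ∷ cB j ∷ cB j′ ∷ [])
    adjacent = adj-next i ∷ adj-prev i ∷ ij ∷ ij′ ∷ []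

  cross-exists : ∀ i → ∃ λ j → Adj G (cA i) (cB j)
  cross-exists i with cubic (cA i)
  ... | f , f-injective , spec = found
    where
    Found = ∃ λ j → Adj G (cA i) (cB j)
    InPair = λ t → f t ≡ cA (next i) ⊎ f t ≡ cA (prev i)

    classify : ∀ t → Found ⊎ InPair t
    classify t with neighbour-cases i (from (spec (f t)) (t , refl))
    ... | inj₁ onA = inj₂ onA
    ... | inj₂ (j , cBj≡ft) =
      inj₁ (j , subst (Adj G (cA i)) (sym cBj≡ft) (from (spec (f t)) (t , refl)))

    found : Found
    found with classify 0F | classify 1F | classify 2F
    ... | inj₁ r  | _       | _       = r
    ... | inj₂ _  | inj₁ r  | _       = r
    ... | inj₂ _  | inj₂ _  | inj₁ r  = r
    ... | inj₂ p₀ | inj₂ p₁ | inj₂ p₂ = contradiction (injective-into-pair⇒≤2 f f-injective in-pair) 1+n≰n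
      where
      in-pair : ∀ t → InPair t
      in-pair 0F = p₀
      in-pair 1F = p₁
      in-pair 2F = p₂

  match : Fin kA → Fin kB
  match i = proj₁ (cross-exists i)

  match-adj : ∀ i → Adj G (cA i) (cB (match i))
  match-adj i = proj₂ (cross-exists i)

  match-unique : ∀ {i j} → Adj G (cA i) (cB j) → match i ≡ j
  match-unique ij = cross-unique (match-adj _) ij

  neighbour : Fin kA → Fin 3 → Fin n
  neighbour i = lookup (cA (next i) ∷ cA (prev i) ∷ cB (match i) ∷ [])

  neighbour-onto : ∀ i {w} → Adj G (cA i) w → ∃ λ t → neighbour i t ≡ w
  neighbour-onto i iw with neighbour-cases i iw
  ... | inj₁ (inj₁ w≡next) = 0F , sym w≡next
  ... | inj₁ (inj₂ w≡prev) = 1F , sym w≡prev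
  ... | inj₂ (j , refl) = 2F , cong cB (match-unique iw)

  proper-on-cycle : ∀ σ i {x y m} → Balanced x y m →
                    σ (cA i) (cA (next i)) ≡ (x , 1F) → σ (cA i) (cA (prev i)) ≡ (y , 1F) →
                    σ (cA i) (cB (match i)) ≡ (m , 0F) → ProperAt G σ (cA i)
  proper-on-cycle σ i {x} {y} {m} (x≢y , sum) σ-next σ-prev σ-match =
    properAt-enumerated G σ (cA i) (neighbour i) (neighbour-onto i) g g-injective σ≡g sum
    where
    colours : Vec Z4×Z2 3
    colours = (x , 1F) ∷ (y , 1F) ∷ (m , 0F) ∷ []

    g : Fin 3 → Z4×Z2
    g = lookup colours

    g-injective : Injective _≡_ _≡_ g
    g-injective {t} {t′} = lookup-injective unique t t′
      where
      unique : Unique colours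
      unique = ((x≢y ∘ cong proj₁) ∷ (λ ()) ∷ []) ∷ ((λ ()) ∷ []) ∷ [] ∷ []

    σ≡g : ∀ t → σ (cA i) (neighbour i t) ≡ g t
    σ≡g 0F = σ-next
    σ≡g 1F = σ-prev
    σ≡g 2F = σ-match

-- Colouring a cubic graph with a 2-factor of two induced cycles

module TwoCycleColouring {n} (G : Graph n) (cubic : Cubic G) {k₁ k₂}
  (c₁ : Fin k₁ → Fin n) (c₂ : Fin k₂ → Fin n)
  (ind₁ : IsInducedCycle G c₁) (ind₂ : IsInducedCycle G c₂)
  (disjoint : ∀ i j → c₁ i ≢ c₂ j)
  (cover : ∀ v → (∃ λ i → c₁ i ≡ v) ⊎ (∃ λ j → c₂ j ≡ v)) where

  module S₁ = FactorCycle G cubic c₁ c₂ ind₁ (proj₁ (proj₂ ind₂)) disjoint cover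
  module S₂ = FactorCycle G cubic c₂ c₁ ind₂ (proj₁ (proj₂ ind₁))
                          (λ j i → disjoint i j ∘ sym) (Sum.swap ∘ cover)

  μ₁ : Fin k₁ → Fin k₂
  μ₁ = S₁.match

  μ₂ : Fin k₂ → Fin k₁
  μ₂ = S₂.match

  μ₂∘μ₁ : ∀ i → μ₂ (μ₁ i) ≡ i
  μ₂∘μ₁ i = S₂.match-unique (adj-sym G (S₁.match-adj i))

  μ₁∘μ₂ : ∀ j → μ₁ (μ₂ j) ≡ j
  μ₁∘μ₂ j = S₁.match-unique (adj-sym G (S₂.match-adj j))

  μ₁-injective : Injective _≡_ _≡_ μ₁
  μ₁-injective {i} {i′} e = trans (sym (μ₂∘μ₁ i)) (trans (cong μ₂ e) (μ₂∘μ₁ i′))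

  μ₂-injective : Injective _≡_ _≡_ μ₂
  μ₂-injective {j} {j′} e = trans (sym (μ₁∘μ₂ j)) (trans (cong μ₁ e) (μ₁∘μ₂ j′))

  k₁≡k₂ : k₁ ≡ k₂
  k₁≡k₂ = ≤-antisym (injective⇒≤ μ₁-injective) (injective⇒≤ μ₂-injective)

  a₁ b₁ : Fin k₁
  a₁ = fromℕ< (≤-trans (s≤s z≤n) S₁.3≤kA)
  b₁ = fromℕ< (≤-trans (s≤s (s≤s z≤n)) S₁.3≤kA)

  a₁≢b₁ : a₁ ≢ b₁
  a₁≢b₁ e = 1+n≢0 (sym (trans (sym (toℕ-fromℕ< _)) (trans (cong toℕ e) (toℕ-fromℕ< _))))

  a₂ b₂ : Fin k₂
  a₂ = μ₁ a₁
  b₂ = μ₁ b₁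

  a₂≢b₂ : a₂ ≢ b₂
  a₂≢b₂ = a₁≢b₁ ∘ μ₁-injective

  m₁ : Fin k₁ → Fin 4
  m₁ = markingColour a₁ b₁

  m₂ : Fin k₂ → Fin 4
  m₂ = m₁ ∘ μ₂

  marking₁ : IsMarking a₁ b₁ m₁
  marking₁ = markingColour-isMarking a₁≢b₁

  marking₂ : IsMarking a₂ b₂ m₂
  marking₂ = record
    { at-b      = trans (cong m₁ (μ₂∘μ₁ b₁))
                        (trans (IsMarking.at-b marking₁) (cong (closingColour ∘ parity ∘ ℕ.pred) k₁≡k₂))
    ; at-a      = trans (cong m₁ (μ₂∘μ₁ a₁)) (IsMarking.at-a marking₁)
    ; elsewhere = λ j≢a₂ j≢b₂ → IsMarking.elsewhere marking₁ (j≢a₂ ∘ to-μ₁) (j≢b₂ ∘ to-μ₁)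
    }
    where
    to-μ₁ : ∀ {j i} → μ₂ j ≡ i → j ≡ μ₁ i
    to-μ₁ {j} e = trans (sym (μ₁∘μ₂ j)) (cong μ₁ e)

  module L₁ = ArcLabelling a₁ b₁ a₁≢b₁
  module L₂ = ArcLabelling a₂ b₂ a₂≢b₂

  locate : Fin n → Fin k₁ ⊎ Fin k₂
  locate v = Sum.map proj₁ proj₁ (cover v)

  locate-c₁ : ∀ i → locate (c₁ i) ≡ inj₁ i
  locate-c₁ i with cover (c₁ i)
  ... | inj₁ (_ , e) = cong inj₁ (S₁.cA-injective e)
  ... | inj₂ (j , e) = contradiction (sym e) (disjoint i j)

  locate-c₂ : ∀ j → locate (c₂ j) ≡ inj₂ j
  locate-c₂ j with cover (c₂ j)
  ... | inj₁ (i , e) = contradiction e (disjoint i j)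
  ... | inj₂ (_ , e) = cong inj₂ (S₂.cA-injective e)

  colourAt : Fin k₁ ⊎ Fin k₂ → Fin k₁ ⊎ Fin k₂ → Z4×Z2
  colourAt (inj₁ i) (inj₁ i′) = edgeLabel L₁.label i i′ , 1F
  colourAt (inj₂ j) (inj₂ j′) = edgeLabel L₂.label j j′ , 1F
  colourAt (inj₁ i) (inj₂ _)  = m₁ i , 0F
  colourAt (inj₂ _) (inj₁ i)  = m₁ i , 0F

  σ : Fin n → Fin n → Z4×Z2
  σ u v = colourAt (locate u) (locate v)

  σ₁₁ : ∀ i i′ → σ (c₁ i) (c₁ i′) ≡ (edgeLabel L₁.label i i′ , 1F)
  σ₁₁ i i′ = cong₂ colourAt (locate-c₁ i) (locate-c₁ i′)

  σ₂₂ : ∀ j j′ → σ (c₂ j) (c₂ j′) ≡ (edgeLabel L₂.label j j′ , 1F)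
  σ₂₂ j j′ = cong₂ colourAt (locate-c₂ j) (locate-c₂ j′)

  σ₁₂ : ∀ i j → σ (c₁ i) (c₂ j) ≡ (m₁ i , 0F)
  σ₁₂ i j = cong₂ colourAt (locate-c₁ i) (locate-c₂ j)

  σ₂₁ : ∀ j i → σ (c₂ j) (c₁ i) ≡ (m₁ i , 0F)
  σ₂₁ j i = cong₂ colourAt (locate-c₂ j) (locate-c₁ i)

  -- Abstracting over cover u and cover v also unfolds σ, so the goals are about colourAt.
  σ-sym : ∀ u v → Adj G u v → σ u v ≡ σ v u
  σ-sym u v uv with cover u | cover v
  ... | inj₁ (i , refl) | inj₁ (i′ , refl) = cong (_, 1F) (edgeLabel-sym S₁.3≤kA L₁.label (S₁.adjA i i′ uv))
  ... | inj₂ (j , refl) | inj₂ (j′ , refl) = cong (_, 1F) (edgeLabel-sym S₂.3≤kA L₂.label (S₂.adjA j j′ uv))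
  ... | inj₁ (_ , refl) | inj₂ (_ , refl) = refl
  ... | inj₂ (_ , refl) | inj₁ (_ , refl) = refl

  σ-nonzero : ∀ u v → Adj G u v → σ u v ≢ 0ₐ
  σ-nonzero u v _ = nonzero (locate u) (locate v)
    where
    nonzero : ∀ l l′ → colourAt l l′ ≢ 0ₐ
    nonzero (inj₁ _) (inj₁ _) ()
    nonzero (inj₂ _) (inj₂ _) ()
    nonzero (inj₁ i) (inj₂ _) e = markingColour≢0 a₁ b₁ i (cong proj₁ e)
    nonzero (inj₂ _) (inj₁ i) e = markingColour≢0 a₁ b₁ i (cong proj₁ e)

  proper-c₁ : ∀ i → ProperAt G σ (c₁ i)
  proper-c₁ i = S₁.proper-on-cycle σ i (L₁.label-balanced marking₁ i)
    (trans (σ₁₁ i _) (cong (_, 1F) (edgeLabel-next L₁.label (next-succ i))))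
    (trans (σ₁₁ i _) (cong (_, 1F) (edgeLabel-prev S₁.3≤kA L₁.label (prev-succ i))))
    (σ₁₂ i _)

  proper-c₂ : ∀ j → ProperAt G σ (c₂ j)
  proper-c₂ j = S₂.proper-on-cycle σ j (L₂.label-balanced marking₂ j)
    (trans (σ₂₂ j _) (cong (_, 1F) (edgeLabel-next L₂.label (next-succ j))))
    (trans (σ₂₂ j _) (cong (_, 1F) (edgeLabel-prev S₂.3≤kA L₂.label (prev-succ j))))
    (σ₂₁ j _)

  proper : ∀ v → ProperAt G σ v
  proper v = [ (λ (i , c₁i≡v) → subst (ProperAt G σ) c₁i≡v (proper-c₁ i))
             , (λ (j , c₂j≡v) → subst (ProperAt G σ) c₂j≡v (proper-c₂ j)) ]′ (cover v)

  σ-isProperZ4Z2Coloring : IsProperZ4Z2Coloring G σ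
  σ-isProperZ4Z2Coloring = (σ-sym , proj₁ ∘ proper) , σ-nonzero , proj₂ ∘ proper

cubic∧twoInducedCycle2Factor⇒Z4Z2Colouring : ∀ {n} (G : Graph n) → Cubic G →
                                             HasTwoInducedCycle2Factor G → HasProperZ4Z2Coloring G
cubic∧twoInducedCycle2Factor⇒Z4Z2Colouring G cubic (_ , _ , c₁ , c₂ , ind₁ , ind₂ , disjoint , cover) =
  σ , σ-isProperZ4Z2Coloring
  where open TwoCycleColouring G cubic c₁ c₂ ind₁ ind₂ disjoint cover

corollary12 : (n : ℕ) (G : Graph n) → IsPermutationSnark G → HasProperZ4Z2Coloring G
corollary12 n G ((cubic , _ , _) , factor) = cubic∧twoInducedCycle2Factor⇒Z4Z2Colouring G cubic factor
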